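{- Let $m \ge 1$ and $1 \le k_1 < k_2 < \cdots < k_m \le n$ be integers. Define binary strings recursively by $S_m = 0_{2^{n-k_m}} 1_{2^{n-k_m}}$ and, for $i = m-1, \ldots, 1$, $S_i = 0_{2^{n-k_i}} \, (S_{i+1})_{2^{k_{i+1}-k_i-1}}$. Then the truth table of the monomial $x_{k_1} x_{k_2} \cdots x_{k_m}$ in $n$ variables is $(S_1)_{2^{k_1-1}}$; that is, $$T^n([k_1,\ldots,k_m]) = \big(0_{2^{n-k_1}}(0_{2^{n-k_2}}(\cdots(0_{2^{n-k_{m-1}}}(0_{2^{n-k_m}}1_{2^{n-k_m}})_{2^{k_m-k_{m-1}-1}})_{2^{k_{m-1}-k_{m-2}-1}}\cdots)_{2^{k_2-k_1-1}}\big)_{2^{k_1-1}}.$$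
   Context: The truth table of a Boolean function $f$ in $n$ variables is the sequence $(f(v_0), \ldots, f(v_{2^n-1}))$ with $v_0=(0,\ldots,0), v_1=(0,\ldots,0,1),\ldots$ listing $GF(2)^n$ in lexicographic order (so $x_1$ is the most significant coordinate). For $a\in\{0,1\}$, $a_k$ denotes $a$ repeated $k$ times; juxtaposition denotes concatenation and $(w)_k$ denotes the string $w$ concatenated with itself $k$ times. -}

module Defs where

open import Data.Nat using (ℕ; zero; suc; _∸_; _^_)
open import Data.Bool using (Bool; true; false; _∧_)
open import Data.List using (List; []; _∷_; _++_; map; replicate; concat)
open import Data.Vec using (Vec; toList)
import Data.Vec as Vec

rep : Bool → ℕ → List Bool
rep a k = replicate k a

pow : List Bool → ℕ → List Bool
pow w k = concat (replicate k w)

-- GF(2)^n listed in lexicographic order, x_1 (first coordinate) most significant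
allVecs : (n : ℕ) → List (Vec Bool n)
allVecs zero = Vec.[] ∷ []
allVecs (suc n) = map (false Vec.∷_) (allVecs n) ++ map (true Vec.∷_) (allVecs n)

-- i-th element (1-based) of a list; out-of-range gives false (never used under the hypotheses)
nth₁ : List Bool → ℕ → Bool
nth₁ [] _ = false
nth₁ (b ∷ bs) zero = false
nth₁ (b ∷ bs) (suc zero) = b
nth₁ (b ∷ bs) (suc (suc i)) = nth₁ bs (suc i)

monomial : {n : ℕ} → List ℕ → Vec Bool n → Bool
monomial [] v = true
monomial (k ∷ ks) v = nth₁ (toList v) k ∧ monomial ks v

truthTable : (n : ℕ) → List ℕ → List Bool
truthTable n ks = map (monomial ks) (allVecs n)

-- S_i for the nonempty index list k_i, k_{i+1}, …, k_m
S : ℕ → ℕ → List ℕ → List Bool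
S n k [] = rep false (2 ^ (n ∸ k)) ++ rep true (2 ^ (n ∸ k))
S n k (k' ∷ ks) = rep false (2 ^ (n ∸ k)) ++ pow (S n k' ks) (2 ^ (k' ∸ k ∸ 1))

-- The proof is by induction on the number n of variables, splitting the
-- lexicographically ordered table of f(x₁,…,x_{n+1}) into its two halves
-- x₁ = 0 and x₁ = 1.  Renumbering x₂,…,x_{n+1} as x₁,…,x_n ("shifting" the
-- index list by one) reduces each half to a table in n variables:
--   * if x₁ does not occur (k₁ ≥ 2), both halves are the shifted table, so the
--     table is that table doubled, i.e. one more factor 2 in the exponent 2^{k₁-1};
--   * if x₁ occurs (k₁ = 1), the first half is 0_{2^n} and the second half is
--     the table of the remaining (shifted) monomial, which is exactly S₁.
-- The strings S_i shift in the same way: S built for n+1 variables from the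
-- indices ks equals S built for n variables from the shifted indices.
module Submission where

open import Defs
open import Data.Nat using (ℕ; _≤_; _<_; _∸_; _^_)
open import Data.Bool using (Bool)
open import Data.List using (List; _∷_)
open import Data.List.Relation.Unary.All using (All)
open import Data.List.Relation.Unary.Linked using (Linked)
open import Relation.Binary.PropositionalEquality using (_≡_)

open import Data.Nat using (zero; suc; _+_; pred; z≤n; s≤s)
open import Data.Nat.Properties using (<-trans; ≤-<-trans; <⇒≤; +-identityʳ)
open import Data.Bool using (true; false; _∧_)
open import Data.List using ([]; _++_; map; length)
open import Data.List.Properties using (++-identityʳ; ++-assoc; map-++; map-∘; map-cong; length-++; length-map)
open import Data.Vec using (Vec; toList)
import Data.Vec as Vec
open import Data.List.Relation.Unary.All using ([]; _∷_)
import Data.List.Relation.Unary.All as All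
open import Data.List.Relation.Unary.Linked using ([]; [-]; _∷_)
open import Data.List.Relation.Unary.Linked.Properties using (Linked⇒All)
open import Function using (_∘_)
open import Relation.Binary.PropositionalEquality using (refl; sym; trans; cong; cong₂; module ≡-Reasoning)

open ≡-Reasoning

pow-one : (w : List Bool) → pow w 1 ≡ w
pow-one = ++-identityʳ

pow-+ : (w : List Bool) (p q : ℕ) → pow w (p + q) ≡ pow w p ++ pow w q
pow-+ w zero    q = refl
pow-+ w (suc p) q = begin
  w ++ pow w (p + q)          ≡⟨ cong (w ++_) (pow-+ w p q) ⟩
  w ++ (pow w p ++ pow w q)   ≡⟨ sym (++-assoc w (pow w p) (pow w q)) ⟩
  (w ++ pow w p) ++ pow w q   ∎

pow-double : (w : List Bool) (j : ℕ) → pow w (2 ^ suc j) ≡ pow w (2 ^ j) ++ pow w (2 ^ j)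
pow-double w j = begin
  pow w (2 ^ j + (2 ^ j + 0))        ≡⟨ pow-+ w (2 ^ j) (2 ^ j + 0) ⟩
  pow w (2 ^ j) ++ pow w (2 ^ j + 0) ≡⟨ cong (λ e → pow w (2 ^ j) ++ pow w e) (+-identityʳ (2 ^ j)) ⟩
  pow w (2 ^ j) ++ pow w (2 ^ j)     ∎

length-allVecs : (n : ℕ) → length (allVecs n) ≡ 2 ^ n
length-allVecs zero    = refl
length-allVecs (suc n) = begin
  length (map (false Vec.∷_) (allVecs n) ++ map (true Vec.∷_) (allVecs n))
    ≡⟨ length-++ (map (false Vec.∷_) (allVecs n)) ⟩
  length (map (false Vec.∷_) (allVecs n)) + length (map (true Vec.∷_) (allVecs n))
    ≡⟨ cong₂ _+_ (length-map (false Vec.∷_) (allVecs n)) (length-map (true Vec.∷_) (allVecs n)) ⟩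
  length (allVecs n) + length (allVecs n)
    ≡⟨ cong₂ _+_ (length-allVecs n) (trans (length-allVecs n) (sym (+-identityʳ (2 ^ n)))) ⟩
  2 ^ n + (2 ^ n + 0) ∎

table-split : {A : Set} (n : ℕ) (f : Vec Bool (suc n) → A) →
  map f (allVecs (suc n)) ≡ map (f ∘ (false Vec.∷_)) (allVecs n) ++ map (f ∘ (true Vec.∷_)) (allVecs n)
table-split n f = begin
  map f (map (false Vec.∷_) (allVecs n) ++ map (true Vec.∷_) (allVecs n))
    ≡⟨ map-++ f (map (false Vec.∷_) (allVecs n)) (map (true Vec.∷_) (allVecs n)) ⟩
  map f (map (false Vec.∷_) (allVecs n)) ++ map f (map (true Vec.∷_) (allVecs n))
    ≡⟨ sym (cong₂ _++_ (map-∘ (allVecs n)) (map-∘ (allVecs n))) ⟩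
  map (f ∘ (false Vec.∷_)) (allVecs n) ++ map (f ∘ (true Vec.∷_)) (allVecs n) ∎

constant-table : (n : ℕ) (b : Bool) (f : Vec Bool n → Bool) → (∀ v → f v ≡ b) →
  map f (allVecs n) ≡ rep b (2 ^ n)
constant-table n b f f≡b = trans (map-constant (allVecs n)) (cong (rep b) (length-allVecs n))
  where
  map-constant : (vs : List (Vec Bool n)) → map f vs ≡ rep b (length vs)
  map-constant []       = refl
  map-constant (v ∷ vs) = cong₂ _∷_ (f≡b v) (map-constant vs)

shift : List ℕ → List ℕ
shift = map pred

monomial-shift : {n : ℕ} (ks : List ℕ) → All (1 <_) ks → (b : Bool) (v : Vec Bool n) →
  monomial ks (b Vec.∷ v) ≡ monomial (shift ks) v
monomial-shift []                 []                     b v = refl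
monomial-shift (suc (suc i) ∷ ks) (s≤s (s≤s z≤n) ∷ 1<ks) b v =
  cong (nth₁ (toList v) (suc i) ∧_) (monomial-shift ks 1<ks b v)

truthTable-empty : (n : ℕ) → truthTable n [] ≡ rep true (2 ^ n)
truthTable-empty n = constant-table n true (monomial []) (λ _ → refl)

truthTable-absent : (n : ℕ) (ks : List ℕ) → All (1 <_) ks →
  truthTable (suc n) ks ≡ truthTable n (shift ks) ++ truthTable n (shift ks)
truthTable-absent n ks 1<ks = trans (table-split n (monomial ks)) (cong₂ _++_ (half false) (half true))
  where
  half : (b : Bool) → map (monomial ks ∘ (b Vec.∷_)) (allVecs n) ≡ truthTable n (shift ks)
  half b = map-cong (monomial-shift ks 1<ks b) (allVecs n)

truthTable-present : (n : ℕ) (ks : List ℕ) → All (1 <_) ks →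
  truthTable (suc n) (1 ∷ ks) ≡ rep false (2 ^ n) ++ truthTable n (shift ks)
truthTable-present n ks 1<ks = trans (table-split n (monomial (1 ∷ ks)))
  (cong₂ _++_ (constant-table n false _ (λ _ → refl))
              (map-cong (monomial-shift ks 1<ks true) (allVecs n)))

S-shift : (n k : ℕ) (ks : List ℕ) → 1 ≤ k → All (1 ≤_) ks →
  S (suc n) k ks ≡ S n (pred k) (shift ks)
S-shift n (suc k) []            _ []           = refl
S-shift n (suc k) (suc k' ∷ ks) _ (1≤k' ∷ 1≤ks) =
  cong (λ w → rep false (2 ^ (n ∸ k)) ++ pow w (2 ^ (k' ∸ k ∸ 1))) (S-shift n (suc k') ks 1≤k' 1≤ks)

above-head : ∀ {k ks} → Linked _<_ (k ∷ ks) → All (k <_) ks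
above-head [-]            = []
above-head (k<k' ∷ rest)  = Linked⇒All <-trans k<k' rest

above-one : ∀ {k ks} → 1 ≤ k → Linked _<_ (k ∷ ks) → All (1 <_) ks
above-one 1≤k increasing = All.map (≤-<-trans 1≤k) (above-head increasing)

shift-increasing : ∀ {k ks} → Linked _<_ (suc k ∷ ks) → Linked _<_ (k ∷ shift ks)
shift-increasing [-]                = [-]
shift-increasing (s≤s k<k' ∷ rest)  = k<k' ∷ shift-increasing rest

shift-bounded : ∀ {n ks} → All (_≤ suc n) ks → All (_≤ n) (shift ks)
shift-bounded []              = []
shift-bounded (z≤n ∷ ks≤)     = z≤n ∷ shift-bounded ks≤
shift-bounded (s≤s k≤n ∷ ks≤) = k≤n ∷ shift-bounded ks≤

Formula : ℕ → Set
Formula n = (k₁ : ℕ) (ks : List ℕ) →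
  1 ≤ k₁ → Linked _<_ (k₁ ∷ ks) → All (λ k → k ≤ n) (k₁ ∷ ks) →
  truthTable n (k₁ ∷ ks) ≡ pow (S n k₁ ks) (2 ^ (k₁ ∸ 1))

formula-zero : Formula zero
formula-zero (suc k) ks _ _ (() ∷ _)

formula-suc : (n : ℕ) → Formula n → Formula (suc n)
formula-suc n _ 1 [] _ _ _ = begin
  truthTable (suc n) (1 ∷ [])                   ≡⟨ truthTable-present n [] [] ⟩
  rep false (2 ^ n) ++ truthTable n []          ≡⟨ cong (rep false (2 ^ n) ++_) (truthTable-empty n) ⟩
  S (suc n) 1 []                                ≡⟨ sym (pow-one _) ⟩
  pow (S (suc n) 1 []) 1                        ∎
formula-suc n ih 1 (suc (suc j) ∷ ks) _ increasing@(_ ∷ rest) (_ ∷ bounded) = begin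
  truthTable (suc n) (1 ∷ suc (suc j) ∷ ks)
    ≡⟨ truthTable-present n (suc (suc j) ∷ ks) (above-one (s≤s z≤n) increasing) ⟩
  rep false (2 ^ n) ++ truthTable n (suc j ∷ shift ks)
    ≡⟨ cong (rep false (2 ^ n) ++_)
         (ih (suc j) (shift ks) (s≤s z≤n) (shift-increasing rest) (shift-bounded bounded)) ⟩
  rep false (2 ^ n) ++ pow (S n (suc j) (shift ks)) (2 ^ j)
    ≡⟨ cong (λ w → rep false (2 ^ n) ++ pow w (2 ^ j))
         (sym (S-shift n (suc (suc j)) ks (s≤s z≤n) (All.map <⇒≤ (above-one (s≤s z≤n) rest)))) ⟩
  S (suc n) 1 (suc (suc j) ∷ ks)
    ≡⟨ sym (pow-one _) ⟩
  pow (S (suc n) 1 (suc (suc j) ∷ ks)) 1 ∎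
formula-suc n _ 1 (suc zero ∷ _) _ (s≤s () ∷ _) _
formula-suc n ih (suc (suc j)) ks _ increasing bounded = begin
  truthTable (suc n) (suc (suc j) ∷ ks)
    ≡⟨ truthTable-absent n (suc (suc j) ∷ ks) (s≤s (s≤s z≤n) ∷ above-one (s≤s z≤n) increasing) ⟩
  truthTable n (suc j ∷ shift ks) ++ truthTable n (suc j ∷ shift ks)
    ≡⟨ cong₂ _++_ shifted shifted ⟩
  pow (S n (suc j) (shift ks)) (2 ^ j) ++ pow (S n (suc j) (shift ks)) (2 ^ j)
    ≡⟨ sym (pow-double _ j) ⟩
  pow (S n (suc j) (shift ks)) (2 ^ suc j)
    ≡⟨ cong (λ w → pow w (2 ^ suc j))
         (sym (S-shift n (suc (suc j)) ks (s≤s z≤n) (All.map <⇒≤ (above-one (s≤s z≤n) increasing)))) ⟩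
  pow (S (suc n) (suc (suc j)) ks) (2 ^ suc j) ∎
  where
  shifted : truthTable n (suc j ∷ shift ks) ≡ pow (S n (suc j) (shift ks)) (2 ^ j)
  shifted = ih (suc j) (shift ks) (s≤s z≤n) (shift-increasing increasing) (shift-bounded bounded)

lemma6 : (n k₁ : ℕ) (ks : List ℕ) →
    1 ≤ k₁ → Linked _<_ (k₁ ∷ ks) → All (λ k → k ≤ n) (k₁ ∷ ks) →
    truthTable n (k₁ ∷ ks) ≡ pow (S n k₁ ks) (2 ^ (k₁ ∸ 1))
lemma6 zero    = formula-zero
lemma6 (suc n) = formula-suc n (lemma6 n)
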